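{- For all positive integers $\ell'$ and $m$, \[\binom{2m}{\ell'-1}-\delta_{\ell'-1,2m}=\binom{2m-\ell'}{\ell'-1}+\sum_{\nu=1}^{\lfloor\ell'/2\rfloor}\left\{\binom{\ell'-\nu}{\nu}+\binom{\ell'-\nu-1}{\nu-1}\right\}\binom{2m-\ell'+\nu}{\ell'-\nu-1},\] where $\delta$ is the Kronecker delta.
   Context: Convention: $\binom{n}{m}=0$ unless the integers $n,m$ satisfy $n\ge m\ge0$. -}

module Defs where

open import Data.Nat using (ℕ; zero; suc)
open import Data.Nat.Combinatorics using (_C_)
open import Data.Integer using (ℤ; +_; -[1+_]; _-_)
open import Relation.Nullary using (yes; no)
import Data.Integer as ℤ

-- Binomial coefficient with integer arguments, using the paper's convention:
-- binom n m = 0 unless n ≥ m ≥ 0 (integers); otherwise the usual n! / (m! (n-m)!).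
-- (For naturals n < m, stdlib's n C m is already 0.)
binom : ℤ → ℤ → ℤ
binom (+ n) (+ m) = + (n C m)
binom (+ n) -[1+ m ] = + 0
binom -[1+ n ] m = + 0

δ : ℤ → ℤ → ℤ
δ a b with a ℤ.≟ b
... | yes _ = + 1
... | no _ = + 0

sum1to : ℕ → (ℕ → ℤ) → ℤ
sum1to zero f = + 0
sum1to (suc N) f = sum1to N f ℤ.+ f (suc N)

-- Write A(l,ν) = C(l−ν,ν) + C(l−ν−1,ν−1) for the coefficients of the Lucas polynomials and
-- S(n,k) = Σ_{ν=0}^{k} A(k+1,ν)·C(n−k−1+ν, k−ν).  Then S(n,k) = C(n,k) − (−1)ⁿ δ_{n,k} for all
-- n, k ≥ 0; the theorem is the case n = 2m, k = ℓ'−1, since the ν = 0 term is the first binomial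
-- on the right and A(l,ν) = 0 once 2ν > l.  Both sides satisfy
-- S(n+2,k+2) = S(n+1,k+2) + S(n,k+1) + S(n,k): on the left by Pascal's rule in the upper index
-- combined with the Lucas recurrence A(l,ν) = A(l−1,ν) + A(l−2,ν−1), on the right by Pascal's
-- rule applied twice.  They agree for k ≤ 1, and for n ≤ 1, k ≥ 2 every term of S(n,k) vanishes.

module Submission where

open import Defs
open import Data.Nat using (ℕ; _/_; _≥_)
open import Data.Integer using (ℤ; +_; _+_; _-_; _*_)
open import Relation.Binary.PropositionalEquality using (_≡_)

open import Algebra.Properties.CommutativeSemigroup as +-Semigroup using ()
open import Data.Empty using (⊥-elim)
open import Data.Integer using (-[1+_]; -_; _≟_)
import Data.Integer.Properties as ℤ
open import Data.Integer.Tactic.RingSolver using (solve; solve-∀)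
open import Data.List using (_∷_; [])
open import Data.Nat using (zero; suc; _≤_; _<_; _≤′_; ≤′-reflexive; ≤′-step; s≤s; s≤s⁻¹; z≤n)
  renaming (_+_ to _+ℕ_; _*_ to _*ℕ_)
open import Data.Nat.Combinatorics using (_C_; nC1≡n; nCk+nC[k+1]≡[n+1]C[k+1]; k>n⇒nCk≡0)
open import Data.Nat.DivMod using (m*n/n≡m; m/n<m; /-monoˡ-≤)
import Data.Nat.Properties as ℕ
open import Data.Product using (_,_)
open import Function using (_∘_)
open import Relation.Binary.PropositionalEquality
  using (refl; sym; trans; cong; cong₂; subst; _≢_; module ≡-Reasoning)
open import Relation.Nullary using (yes; no)

open ≡-Reasoning
open +-Semigroup ℤ.+-commutativeSemigroup using (interchange)

binom-negʳ : ∀ p r → binom p -[1+ r ] ≡ + 0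
binom-negʳ (+ _) _ = refl
binom-negʳ -[1+ _ ] _ = refl

binom-lower>upper : ∀ p q r → q - p ≡ + suc r → binom p q ≡ + 0
binom-lower>upper -[1+ _ ] q r e = refl
binom-lower>upper (+ a) -[1+ _ ] r e = refl
binom-lower>upper (+ a) (+ b) r e = cong +_ (k>n⇒nCk≡0 a<b)
  where
  b≡ : + b ≡ + suc r + + a
  b≡ = trans (sub-add (+ b) (+ a)) (cong (_+ + a) e)
    where
    sub-add : ∀ x y → x ≡ (x - y) + y
    sub-add = solve-∀
  a<b : a < b
  a<b rewrite ℤ.+-injective b≡ = s≤s (ℕ.m≤n+m a r)

binom-pascal : ∀ p q → p + q ≢ + 0 → binom p q ≡ binom (p - + 1) q + binom (p - + 1) (q - + 1)
binom-pascal -[1+ _ ] q p+q≢0 = refl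
binom-pascal (+ zero) -[1+ _ ] p+q≢0 = refl
binom-pascal (+ zero) (+ zero) p+q≢0 = ⊥-elim (p+q≢0 refl)
binom-pascal (+ zero) (+ suc b) p+q≢0 = refl
binom-pascal (+ suc a) -[1+ _ ] p+q≢0 = refl
binom-pascal (+ suc a) (+ zero) p+q≢0 = refl
binom-pascal (+ suc a) (+ suc b) p+q≢0 = cong +_ (begin
  suc a C suc b          ≡⟨ sym (nCk+nC[k+1]≡[n+1]C[k+1] a b) ⟩
  a C b +ℕ a C suc b     ≡⟨ ℕ.+-comm (a C b) _ ⟩
  a C suc b +ℕ a C b     ∎)

lucasCoeff : ℤ → ℤ → ℤ
lucasCoeff l ν = binom (l - ν) ν + binom (l - ν - + 1) (ν - + 1)

lucasCoeff-rec : ∀ l ν → l ≢ + 0 → l - + 2 ≢ + 0 →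
  lucasCoeff l ν ≡ lucasCoeff (l - + 1) ν + lucasCoeff (l - + 2) (ν - + 1)
lucasCoeff-rec l ν l≢0 l-2≢0 = begin
  binom (l - ν) ν + binom (l - ν - + 1) (ν - + 1)
    ≡⟨ cong₂ _+_ (binom-pascal (l - ν) ν (l≢0 ∘ trans l≡))
                 (binom-pascal (l - ν - + 1) (ν - + 1) (l-2≢0 ∘ trans l-2≡)) ⟩
  (binom a ν + binom a (ν - + 1)) + (binom b (ν - + 1) + binom b (ν - + 1 - + 1))
    ≡⟨ interchange (binom a ν) (binom a (ν - + 1)) (binom b (ν - + 1)) (binom b (ν - + 1 - + 1)) ⟩
  (binom a ν + binom b (ν - + 1)) + (binom a (ν - + 1) + binom b (ν - + 1 - + 1))
    ≡⟨ cong₂ _+_ (cong₂ _+_ (cong (λ x → binom x ν) a≡) (cong (λ x → binom x (ν - + 1)) b≡))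
                 (cong₂ _+_ (cong (λ x → binom x (ν - + 1)) a≡′) (cong (λ x → binom x (ν - + 1 - + 1)) b≡′)) ⟩
  lucasCoeff (l - + 1) ν + lucasCoeff (l - + 2) (ν - + 1) ∎
  where
  a = l - ν - + 1
  b = l - ν - + 1 - + 1
  l≡ : l ≡ (l - ν) + ν
  l≡ = solve (l ∷ ν ∷ [])
  l-2≡ : l - + 2 ≡ (l - ν - + 1) + (ν - + 1)
  l-2≡ = solve (l ∷ ν ∷ [])
  a≡ : l - ν - + 1 ≡ l - + 1 - ν
  a≡ = solve (l ∷ ν ∷ [])
  b≡ : l - ν - + 1 - + 1 ≡ l - + 1 - ν - + 1
  b≡ = solve (l ∷ ν ∷ [])
  a≡′ : l - ν - + 1 ≡ l - + 2 - (ν - + 1)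
  a≡′ = solve (l ∷ ν ∷ [])
  b≡′ : l - ν - + 1 - + 1 ≡ l - + 2 - (ν - + 1) - + 1
  b≡′ = solve (l ∷ ν ∷ [])

lucasCoeff-vanish : ∀ {l ν} → l < ν +ℕ ν → lucasCoeff (+ l) (+ ν) ≡ + 0
lucasCoeff-vanish {l} {ν} l<2ν with ℕ.m≤n⇒∃[o]m+o≡n l<2ν
... | r , 1+l+r≡2ν = cong₂ _+_
  (binom-lower>upper (+ l - + ν) (+ ν) r (excess (+ l) (+ ν) (+ r) (cong +_ (sym 1+l+r≡2ν))))
  (binom-lower>upper (+ l - + ν - + 1) (+ ν - + 1) r (excess′ (+ l) (+ ν) (+ r) (cong +_ (sym 1+l+r≡2ν))))
  where
  excess : ∀ l ν r → ν + ν ≡ + 1 + l + r → ν - (l - ν) ≡ + 1 + r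
  excess l ν r e = begin
    ν - (l - ν)        ≡⟨ solve (l ∷ ν ∷ []) ⟩
    (ν + ν) - l        ≡⟨ cong (_- l) e ⟩
    (+ 1 + l + r) - l  ≡⟨ solve (l ∷ r ∷ []) ⟩
    + 1 + r            ∎
  excess′ : ∀ l ν r → ν + ν ≡ + 1 + l + r → (ν - + 1) - (l - ν - + 1) ≡ + 1 + r
  excess′ l ν r e = begin
    (ν - + 1) - (l - ν - + 1)  ≡⟨ solve (l ∷ ν ∷ []) ⟩
    ν - (l - ν)                ≡⟨ excess l ν r e ⟩
    + 1 + r                    ∎

term : ℤ → ℤ → ℤ → ℤ
term N l ν = lucasCoeff l ν * binom (N - l + ν) (l - ν - + 1)

term-rec : ∀ N l ν → l ≢ + 0 → l - + 2 ≢ + 0 → N - + 1 ≢ + 0 →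
  term N l ν ≡ term (N - + 1) l ν + term (N - + 2) (l - + 1) ν + term (N - + 2) (l - + 2) (ν - + 1)
term-rec N l ν l≢0 l-2≢0 N-1≢0 = begin
  A₀ * binom (N - l + ν) (l - ν - + 1)
    ≡⟨ cong (A₀ *_) (binom-pascal (N - l + ν) (l - ν - + 1) (N-1≢0 ∘ trans N-1≡)) ⟩
  A₀ * (binom P Q + binom P (Q - + 1))
    ≡⟨ ℤ.*-distribˡ-+ A₀ (binom P Q) (binom P (Q - + 1)) ⟩
  A₀ * binom P Q + A₀ * binom P (Q - + 1)
    ≡⟨ cong (λ x → A₀ * binom P Q + x * binom P (Q - + 1)) (lucasCoeff-rec l ν l≢0 l-2≢0) ⟩
  A₀ * binom P Q + (A₁ + A₂) * binom P (Q - + 1)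
    ≡⟨ cong (λ x → A₀ * binom P Q + x) (ℤ.*-distribʳ-+ (binom P (Q - + 1)) A₁ A₂) ⟩
  A₀ * binom P Q + (A₁ * binom P (Q - + 1) + A₂ * binom P (Q - + 1))
    ≡⟨ sym (ℤ.+-assoc (A₀ * binom P Q) _ _) ⟩
  A₀ * binom P Q + A₁ * binom P (Q - + 1) + A₂ * binom P (Q - + 1)
    ≡⟨ cong₂ _+_ (cong₂ _+_ (cong (λ p → A₀ * binom p Q) P≡₀)
                            (cong₂ (λ p q → A₁ * binom p q) P≡₁ Q≡₁))
                 (cong₂ (λ p q → A₂ * binom p q) P≡₂ Q≡₂) ⟩
  term (N - + 1) l ν + term (N - + 2) (l - + 1) ν + term (N - + 2) (l - + 2) (ν - + 1) ∎
  where
  A₀ = lucasCoeff l ν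
  A₁ = lucasCoeff (l - + 1) ν
  A₂ = lucasCoeff (l - + 2) (ν - + 1)
  P = N - l + ν - + 1
  Q = l - ν - + 1
  N-1≡ : N - + 1 ≡ (N - l + ν) + (l - ν - + 1)
  N-1≡ = solve (N ∷ l ∷ ν ∷ [])
  P≡₀ : N - l + ν - + 1 ≡ N - + 1 - l + ν
  P≡₀ = solve (N ∷ l ∷ ν ∷ [])
  P≡₁ : N - l + ν - + 1 ≡ N - + 2 - (l - + 1) + ν
  P≡₁ = solve (N ∷ l ∷ ν ∷ [])
  Q≡₁ : l - ν - + 1 - + 1 ≡ l - + 1 - ν - + 1
  Q≡₁ = solve (l ∷ ν ∷ [])
  P≡₂ : N - l + ν - + 1 ≡ N - + 2 - (l - + 2) + (ν - + 1)
  P≡₂ = solve (N ∷ l ∷ ν ∷ [])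
  Q≡₂ : l - ν - + 1 - + 1 ≡ l - + 2 - (ν - + 1) - + 1
  Q≡₂ = solve (l ∷ ν ∷ [])

term-upper-neg : ∀ N l ν r → N - l + ν ≡ -[1+ r ] → term N l ν ≡ + 0
term-upper-neg N l ν r e =
  trans (cong (λ p → lucasCoeff l ν * binom p (l - ν - + 1)) e) (ℤ.*-zeroʳ (lucasCoeff l ν))

term-lower-neg : ∀ N l ν r → l - ν - + 1 ≡ -[1+ r ] → term N l ν ≡ + 0
term-lower-neg N l ν r e = begin
  lucasCoeff l ν * binom (N - l + ν) (l - ν - + 1)  ≡⟨ cong (λ q → lucasCoeff l ν * binom (N - l + ν) q) e ⟩
  lucasCoeff l ν * binom (N - l + ν) -[1+ r ]       ≡⟨ cong (lucasCoeff l ν *_) (binom-negʳ (N - l + ν) r) ⟩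
  lucasCoeff l ν * + 0                              ≡⟨ ℤ.*-zeroʳ (lucasCoeff l ν) ⟩
  + 0                                               ∎

term-negʳ : ∀ N l r → term N l -[1+ r ] ≡ + 0
term-negʳ N l r = cong (_* binom (N - l + -[1+ r ]) (l - -[1+ r ] - + 1))
  (cong₂ _+_ (binom-negʳ (l - -[1+ r ]) r) (binom-negʳ (l - -[1+ r ] - + 1) _))

term-diagonal : ∀ N l → term N l l ≡ + 0
term-diagonal N l = term-lower-neg N l l 0 (solve (l ∷ []))

term-below : ∀ {N l ν} → N +ℕ ν < l → term (+ N) (+ l) (+ ν) ≡ + 0
term-below {N} {l} {ν} N+ν<l with ℕ.m≤n⇒∃[o]m+o≡n N+ν<l
... | d , refl = term-upper-neg (+ N) (+ (suc (N +ℕ ν) +ℕ d)) (+ ν) d (deficit (+ N) (+ ν) (+ d))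
  where
  deficit : ∀ N ν d → N - (+ 1 + N + ν + d) + ν ≡ - (+ 1 + d)
  deficit N ν d = solve (N ∷ ν ∷ d ∷ [])

term-at-0 : ∀ n l → term (+ n) (+ l) (+ 0) ≡ binom (+ n - + l) (+ l - + 1)
term-at-0 n l = begin
  lucasCoeff (+ l) (+ 0) * binom (+ n - + l + + 0) (+ l - + 0 - + 1)
    ≡⟨ cong (_* binom (+ n - + l + + 0) (+ l - + 0 - + 1))
            (cong (λ t → binom (+ l - + 0) (+ 0) + t) (binom-negʳ (+ l - + 0 - + 1) 0)) ⟩
  + 1 * binom (+ n - + l + + 0) (+ l - + 0 - + 1)
    ≡⟨ ℤ.*-identityˡ _ ⟩
  binom (+ n - + l + + 0) (+ l - + 0 - + 1)
    ≡⟨ cong₂ binom (ℤ.+-identityʳ (+ n - + l)) (cong (_- + 1) (ℤ.+-identityʳ (+ l))) ⟩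
  binom (+ n - + l) (+ l - + 1) ∎

/2<⇒<double : ∀ {l ν} → l / 2 < ν → l < ν +ℕ ν
/2<⇒<double {l} {ν} l/2<ν = ℕ.≰⇒> (ℕ.<⇒≱ l/2<ν ∘ ν≤l/2)
  where
  ν*2≡ν+ν : ν *ℕ 2 ≡ ν +ℕ ν
  ν*2≡ν+ν = trans (ℕ.*-comm ν 2) (cong (ν +ℕ_) (ℕ.+-identityʳ ν))
  ν≤l/2 : ν +ℕ ν ≤ l → ν ≤ l / 2
  ν≤l/2 2ν≤l = subst (_≤ l / 2) (m*n/n≡m ν 2) (/-monoˡ-≤ 2 (subst (_≤ l) (sym ν*2≡ν+ν) 2ν≤l))

term-beyond-half : ∀ N l {ν} → l / 2 < ν → term N (+ l) (+ ν) ≡ + 0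
term-beyond-half N l {ν} l/2<ν =
  cong (_* binom (N - + l + + ν) (+ l - + ν - + 1)) (lucasCoeff-vanish {l} {ν} (/2<⇒<double l/2<ν))

sum0to : ℕ → (ℕ → ℤ) → ℤ
sum0to zero f = f 0
sum0to (suc K) f = sum0to K f + f (suc K)

sum0to-cong : ∀ K {f g : ℕ → ℤ} → (∀ ν → f ν ≡ g ν) → sum0to K f ≡ sum0to K g
sum0to-cong zero f≗g = f≗g 0
sum0to-cong (suc K) f≗g = cong₂ _+_ (sum0to-cong K f≗g) (f≗g (suc K))

sum0to-+ : ∀ K (f g : ℕ → ℤ) → sum0to K (λ ν → f ν + g ν) ≡ sum0to K f + sum0to K g
sum0to-+ zero f g = refl
sum0to-+ (suc K) f g = trans (cong (_+ (f (suc K) + g (suc K))) (sum0to-+ K f g))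
  (interchange (sum0to K f) (sum0to K g) (f (suc K)) (g (suc K)))

sum0to-shift : ∀ K (f : ℕ → ℤ) → sum0to (suc K) f ≡ f 0 + sum0to K (f ∘ suc)
sum0to-shift zero f = refl
sum0to-shift (suc K) f = trans (cong (_+ f (suc (suc K))) (sum0to-shift K f))
  (ℤ.+-assoc (f 0) (sum0to K (f ∘ suc)) (f (suc (suc K))))

sum0to-vanish : ∀ K (f : ℕ → ℤ) → (∀ {ν} → ν ≤ K → f ν ≡ + 0) → sum0to K f ≡ + 0
sum0to-vanish zero f f≡0 = f≡0 ℕ.≤-refl
sum0to-vanish (suc K) f f≡0 =
  cong₂ _+_ (sum0to-vanish K f (f≡0 ∘ ℕ.m≤n⇒m≤1+n)) (f≡0 ℕ.≤-refl)

sum0to≡head+sum1to : ∀ K (f : ℕ → ℤ) → sum0to K f ≡ f 0 + sum1to K f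
sum0to≡head+sum1to zero f = sym (ℤ.+-identityʳ (f 0))
sum0to≡head+sum1to (suc K) f = trans (cong (_+ f (suc K)) (sum0to≡head+sum1to K f))
  (ℤ.+-assoc (f 0) (sum1to K f) (f (suc K)))

sum1to-vanishing-tail : ∀ {K L} (f : ℕ → ℤ) → K ≤′ L → (∀ {ν} → K < ν → f ν ≡ + 0) →
  sum1to L f ≡ sum1to K f
sum1to-vanishing-tail f (≤′-reflexive refl) f≡0 = refl
sum1to-vanishing-tail {K} {suc L} f (≤′-step K≤′L) f≡0 =
  trans (cong₂ _+_ (sum1to-vanishing-tail f K≤′L f≡0) (f≡0 (s≤s (ℕ.≤′⇒≤ K≤′L))))
        (ℤ.+-identityʳ (sum1to K f))

lucasSum : ℤ → ℕ → ℤ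
lucasSum N k = sum0to k (λ ν → term N (+ suc k) (+ ν))

lucasSum-rec : ∀ n j → lucasSum (+ suc (suc n)) (suc (suc j))
  ≡ lucasSum (+ suc n) (suc (suc j)) + lucasSum (+ n) (suc j) + lucasSum (+ n) j
lucasSum-rec n j = begin
  sum0to K (λ ν → term (+ suc (suc n)) l (+ ν))
    ≡⟨ sum0to-cong K (λ ν → term-rec (+ suc (suc n)) l (+ ν) (λ ()) (λ ()) (λ ())) ⟩
  sum0to K (λ ν → t₀ ν + t₁ ν + t₂ ν)
    ≡⟨ sum0to-+ K (λ ν → t₀ ν + t₁ ν) t₂ ⟩
  sum0to K (λ ν → t₀ ν + t₁ ν) + sum0to K t₂
    ≡⟨ cong (_+ sum0to K t₂) (sum0to-+ K t₀ t₁) ⟩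
  sum0to K t₀ + sum0to K t₁ + sum0to K t₂
    ≡⟨ cong₂ (λ x y → sum0to K t₀ + x + y) drop-diagonal shift-down ⟩
  lucasSum (+ suc n) (suc (suc j)) + lucasSum (+ n) (suc j) + lucasSum (+ n) j ∎
  where
  K = suc (suc j)
  l = + suc K
  t₀ t₁ t₂ : ℕ → ℤ
  t₀ ν = term (+ suc n) l (+ ν)
  t₁ ν = term (+ n) (+ K) (+ ν)
  t₂ ν = term (+ n) (+ suc j) (+ ν - + 1)
  drop-diagonal : sum0to K t₁ ≡ lucasSum (+ n) (suc j)
  drop-diagonal = trans (cong (λ x → lucasSum (+ n) (suc j) + x) (term-diagonal (+ n) (+ K)))
                        (ℤ.+-identityʳ (lucasSum (+ n) (suc j)))
  shift-down : sum0to K t₂ ≡ lucasSum (+ n) j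
  shift-down = begin
    sum0to K t₂
      ≡⟨ sum0to-shift (suc j) t₂ ⟩
    t₂ 0 + (lucasSum (+ n) j + term (+ n) (+ suc j) (+ suc j))
      ≡⟨ cong₂ _+_ (term-negʳ (+ n) (+ suc j) 0) (cong (λ x → lucasSum (+ n) j + x) (term-diagonal (+ n) (+ suc j))) ⟩
    + 0 + (lucasSum (+ n) j + + 0)
      ≡⟨ trans (ℤ.+-identityˡ _) (ℤ.+-identityʳ (lucasSum (+ n) j)) ⟩
    lucasSum (+ n) j ∎

-- diagCorrection n k = −(−1)ⁿ δ_{n,k}; for even n this is the −δ of the statement.
diagCorrection : ℕ → ℕ → ℤ
diagCorrection zero zero = -[1+ 0 ]
diagCorrection zero (suc k) = + 0
diagCorrection (suc n) zero = + 0
diagCorrection (suc n) (suc k) = - diagCorrection n k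

diagCorrection-off : ∀ n k → n ≢ k → diagCorrection n k ≡ + 0
diagCorrection-off zero zero n≢k = ⊥-elim (n≢k refl)
diagCorrection-off zero (suc k) n≢k = refl
diagCorrection-off (suc n) zero n≢k = refl
diagCorrection-off (suc n) (suc k) n≢k = cong -_ (diagCorrection-off n k (n≢k ∘ cong suc))

diagCorrection-double : ∀ m → diagCorrection (m +ℕ m) (m +ℕ m) ≡ -[1+ 0 ]
diagCorrection-double zero = refl
diagCorrection-double (suc m) rewrite ℕ.+-suc m m =
  trans (ℤ.neg-involutive (diagCorrection (m +ℕ m) (m +ℕ m))) (diagCorrection-double m)

diagCorrection-even : ∀ m k → diagCorrection (2 *ℕ m) k ≡ - δ (+ k) (+ (2 *ℕ m))
diagCorrection-even m k with + k ≟ + (2 *ℕ m)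
... | yes k≡2m rewrite ℤ.+-injective k≡2m | ℕ.+-identityʳ m = diagCorrection-double m
... | no k≢2m = diagCorrection-off (2 *ℕ m) k (k≢2m ∘ cong +_ ∘ sym)

closedForm : ℕ → ℕ → ℤ
closedForm n k = + (n C k) + diagCorrection n k

C-rec₃ : ∀ n j → suc (suc n) C suc (suc j) ≡ suc n C suc (suc j) +ℕ n C suc j +ℕ n C j
C-rec₃ n j = begin
  suc (suc n) C suc (suc j)                  ≡⟨ sym (nCk+nC[k+1]≡[n+1]C[k+1] (suc n) (suc j)) ⟩
  suc n C suc j +ℕ suc n C suc (suc j)       ≡⟨ cong (_+ℕ suc n C suc (suc j)) (sym (nCk+nC[k+1]≡[n+1]C[k+1] n j)) ⟩
  n C j +ℕ n C suc j +ℕ suc n C suc (suc j)  ≡⟨ ℕ.+-comm (n C j +ℕ n C suc j) _ ⟩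
  suc n C suc (suc j) +ℕ (n C j +ℕ n C suc j) ≡⟨ cong (suc n C suc (suc j) +ℕ_) (ℕ.+-comm (n C j) _) ⟩
  suc n C suc (suc j) +ℕ (n C suc j +ℕ n C j) ≡⟨ sym (ℕ.+-assoc (suc n C suc (suc j)) _ _) ⟩
  suc n C suc (suc j) +ℕ n C suc j +ℕ n C j  ∎

closedForm-rec : ∀ n j → closedForm (suc (suc n)) (suc (suc j))
  ≡ closedForm (suc n) (suc (suc j)) + closedForm n (suc j) + closedForm n j
closedForm-rec n j = begin
  + (suc (suc n) C suc (suc j)) + - - c₀
    ≡⟨ cong₂ _+_ (cong +_ (C-rec₃ n j)) (ℤ.neg-involutive c₀) ⟩
  + (suc n C suc (suc j)) + + (n C suc j) + + (n C j) + c₀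
    ≡⟨ regroup (+ (suc n C suc (suc j))) (+ (n C suc j)) (+ (n C j)) c₁ c₀ ⟩
  (+ (suc n C suc (suc j)) - c₁) + (+ (n C suc j) + c₁) + (+ (n C j) + c₀) ∎
  where
  c₀ = diagCorrection n j
  c₁ = diagCorrection n (suc j)
  regroup : ∀ a b d c₁ c₀ → a + b + d + c₀ ≡ (a - c₁) + (b + c₁) + (d + c₀)
  regroup = solve-∀

lucasSum-k=0 : ∀ n → lucasSum (+ n) 0 ≡ closedForm n 0
lucasSum-k=0 zero = refl
lucasSum-k=0 (suc n) = refl

lucasSum-k=1 : ∀ n → lucasSum (+ n) 1 ≡ closedForm n 1
lucasSum-k=1 zero = refl
lucasSum-k=1 (suc zero) = refl
lucasSum-k=1 (suc (suc n)) = begin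
  term N (+ 2) (+ 0) + term N (+ 2) (+ 1)  ≡⟨ cong (_+ term N (+ 2) (+ 1)) first-term ⟩
  + (n +ℕ 2)                               ≡⟨ cong +_ (ℕ.+-comm n 2) ⟩
  + suc (suc n)                            ≡⟨ cong +_ (sym (nC1≡n (suc (suc n)))) ⟩
  + (suc (suc n) C 1)                      ≡⟨ sym (ℤ.+-identityʳ _) ⟩
  closedForm (suc (suc n)) 1               ∎
  where
  N = + suc (suc n)
  first-term : term N (+ 2) (+ 0) ≡ + n
  first-term = trans (term-at-0 (suc (suc n)) 2) (cong +_ (nC1≡n n))

lucasSum-n=0 : ∀ j → lucasSum (+ 0) (suc (suc j)) ≡ closedForm 0 (suc (suc j))
lucasSum-n=0 j = sum0to-vanish (suc (suc j)) _ (λ {ν} ν≤ → term-below {ν = ν} (s≤s ν≤))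

lucasSum-n=1 : ∀ j → lucasSum (+ 1) (suc (suc j)) ≡ closedForm 1 (suc (suc j))
lucasSum-n=1 j = cong₂ _+_
  (sum0to-vanish (suc j) _ (λ {ν} ν≤ → term-below {ν = ν} (s≤s (s≤s ν≤))))
  (cong (_* binom (+ 1 - + l + + suc (suc j)) (+ l - + suc (suc j) - + 1))
        (lucasCoeff-vanish {l} {suc (suc j)} (s≤s (s≤s (ℕ.m≤n+m (suc (suc j)) j)))))
  where
  l = suc (suc (suc j))

lucasSum≡closedForm : ∀ n k → lucasSum (+ n) k ≡ closedForm n k
lucasSum≡closedForm n zero = lucasSum-k=0 n
lucasSum≡closedForm n (suc zero) = lucasSum-k=1 n
lucasSum≡closedForm zero (suc (suc j)) = lucasSum-n=0 j
lucasSum≡closedForm (suc zero) (suc (suc j)) = lucasSum-n=1 j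
lucasSum≡closedForm (suc (suc n)) (suc (suc j)) = begin
  lucasSum (+ suc (suc n)) (suc (suc j))
    ≡⟨ lucasSum-rec n j ⟩
  lucasSum (+ suc n) (suc (suc j)) + lucasSum (+ n) (suc j) + lucasSum (+ n) j
    ≡⟨ cong₂ _+_ (cong₂ _+_ (lucasSum≡closedForm (suc n) (suc (suc j))) (lucasSum≡closedForm n (suc j)))
                 (lucasSum≡closedForm n j) ⟩
  closedForm (suc n) (suc (suc j)) + closedForm n (suc j) + closedForm n j
    ≡⟨ sym (closedForm-rec n j) ⟩
  closedForm (suc (suc n)) (suc (suc j)) ∎

corollaryB2 : (l m : ℕ) → l ≥ 1 → m ≥ 1 →
    binom (+ (2 Data.Nat.* m)) (+ l - + 1) - δ (+ l - + 1) (+ (2 Data.Nat.* m))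
      ≡ binom (+ (2 Data.Nat.* m) - + l) (+ l - + 1)
        + sum1to (l / 2) (λ ν →
            (binom (+ l - + ν) (+ ν) + binom (+ l - + ν - + 1) (+ ν - + 1))
            * binom (+ (2 Data.Nat.* m) - + l + + ν) (+ l - + ν - + 1))
corollaryB2 zero m () _
corollaryB2 l@(suc k) m _ _ = begin
  binom (+ n) (+ k) - δ (+ k) (+ n)
    ≡⟨ cong (λ c → binom (+ n) (+ k) + c) (sym (diagCorrection-even m k)) ⟩
  closedForm n k
    ≡⟨ sym (lucasSum≡closedForm n k) ⟩
  lucasSum (+ n) k
    ≡⟨ sum0to≡head+sum1to k f ⟩
  f 0 + sum1to k f
    ≡⟨ cong₂ _+_ (term-at-0 n l) (sum1to-vanishing-tail f (ℕ.≤⇒≤′ l/2≤k) (term-beyond-half (+ n) l)) ⟩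
  binom (+ n - + l) (+ l - + 1) + sum1to (l / 2) f ∎
  where
  n = 2 *ℕ m
  f : ℕ → ℤ
  f ν = term (+ n) (+ l) (+ ν)
  l/2≤k : l / 2 ≤ k
  l/2≤k = s≤s⁻¹ (m/n<m l 2 (s≤s (s≤s z≤n)))
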